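{- Let $T$ be an $i$-element subset of $[r]$. Then there are at least $\lfloor r-\tfrac52 i\rfloor$ subsets $S\subseteq[r]$ with $T\subseteq S$ and $|S|=i+1$ such that $S$ dominates $T$.
   Context: For $\pi=a_1\cdots a_{r+1}\in S_{r+1}$ the descent set is $\{j\in[r]:a_j>a_{j+1}\}$ and $D(T)$ is the set of permutations in $S_{r+1}$ with descent set $T$. The inversion set is $I(\pi)=\{(a_j,a_k):j<k,\ a_j>a_k\}$ and the weak Bruhat order is $\pi\le_w\pi'$ iff $I(\pi)\subseteq I(\pi')$. $S$ dominates $T$ if there is an injection $\phi:D(T)\to D(S)$ with $\pi\le_w\phi(\pi)$ for all $\pi\in D(T)$. -}

module Defs where

open import Data.Nat using (ℕ; suc)
open import Data.Fin using (Fin; inject₁; _<_; _<?_) renaming (suc to fsuc)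
open import Data.Fin.Subset using (Subset)
open import Data.Vec using (Vec; lookup; tabulate)
open import Data.Product using (Σ; ∃; ∃-syntax; _×_)
open import Relation.Nullary using (does)
open import Relation.Binary.PropositionalEquality using (_≡_)

-- A word of length n over the alphabet Fin n (values 0..n-1 stand for 1..n).
Word : ℕ → Set
Word n = Vec (Fin n) n

IsPerm : ∀ {n} → Word n → Set
IsPerm {n} v = ∀ (i j : Fin n) → lookup v i ≡ lookup v j → i ≡ j

-- Descent set of a permutation of S_{r+1}, as a subset of [r]
-- (position j : Fin r stands for j+1 ∈ [r]; it is a descent iff a_j > a_{j+1}).
descentSet : ∀ {r} → Word (suc r) → Subset r
descentSet v = tabulate λ j → does (lookup v (fsuc j) <? lookup v (inject₁ j))

InD : ∀ {r} → Subset r → Word (suc r) → Set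
InD T v = IsPerm v × descentSet v ≡ T

Inv : ∀ {n} → Word n → Fin n → Fin n → Set
Inv {n} v a b = ∃[ j ] ∃[ k ] (j < k × lookup v j ≡ a × lookup v k ≡ b × b < a)

_≤w_ : ∀ {n} → Word n → Word n → Set
v ≤w w = ∀ a b → Inv v a b → Inv w a b

Dominates : ∀ {r} → Subset r → Subset r → Set
Dominates {r} S T =
  Σ ((v : Word (suc r)) → InD T v → Word (suc r)) λ φ →
      (∀ v (p : InD T v) → InD S (φ v p))
    × (∀ v w (p : InD T v) (q : InD T w) → φ v p ≡ φ w q → v ≡ w)
    × (∀ v (p : InD T v) → v ≤w φ v p)

module Submission where

-- A position d ∉ T is good when T looks, around d, like one of three local patterns: no
-- descent at d−1, d, d+1; among d−2,…,d+2 a descent at d−1 only; among d−3,…,d+3 descents at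
-- d−1 and d+2 only. For each pattern T ∪ {d} dominates T: the injection keeps a permutation
-- outside a window of at most six consecutive letters and rearranges the letters inside by a
-- table indexed by their relative order. The tables keep every inversion, create the descent
-- at d, keep the ascents at the two ends of the window, and can be undone from the relative
-- order of the rearranged window alone; all of this is verified by exhaustive search. A
-- potential on six consecutive cells of the padded descent word, again checked exhaustively,
-- shows that every element of T costs at most 5/2 good positions: 2·#good + 5|T| + 1 ≥ 2r.

open import Defs
open import Data.Bool using (Bool; true; false; T; not; _∧_; _∨_; if_then_else_)
import Data.Bool as Bool
open import Data.Bool.Properties using (T-∧; T-∨; T-≡)
open import Data.Empty using (⊥; ⊥-elim)
open import Data.Fin as Fin using (Fin; zero; suc; toℕ; fromℕ<; fromℕ; inject₁)
import Data.Fin.Properties as Finₚ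
open import Data.Fin.Subset using (Subset; _∈_; _⊆_; ∣_∣)
open import Data.Fin.Subset.Properties using (p⊂q⇒∣p∣<∣q∣; ∈⊤; ∣⊤∣≡n)
open import Data.List using (List; []; _∷_; map; length)
open import Data.List.Properties using (length-map)
open import Data.List.Relation.Unary.All as All using (All; []; _∷_)
import Data.List.Relation.Unary.All.Properties as Allₚ
open import Data.List.Relation.Unary.AllPairs using ([]; _∷_)
open import Data.List.Relation.Unary.Unique.Propositional using (Unique)
import Data.List.Relation.Unary.Unique.Propositional.Properties as Uniqueₚ
open import Data.Nat as ℕ using (ℕ; zero; suc; _+_; _*_; _∸_; _/_; _<_; _≤_; _≤ᵇ_; _≡ᵇ_; s≤s; z≤n)
open import Data.Nat.DivMod using (m<n*o⇒m/o<n)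
open import Data.Nat.Properties
  using ( ≤-trans; ≤-reflexive; <-trans; <-irrefl; <-asym; <-cmp; ≮⇒≥; <⇒≱; <-≤-trans; ≤-<-trans
        ; +-monoʳ-≤; +-monoʳ-<; +-monoˡ-≤; +-cancelˡ-≡; +-cancelʳ-≡; +-cancelˡ-<; +-cancelʳ-≤
        ; m≤m+n; m+[n∸m]≡n; +-suc; +-identityʳ; +-assoc; +-comm; n<1+n; m≤n⇒m≤1+n; ≤ᵇ⇒≤; ≤-pred
        ; m≤n+o⇒m∸n≤o; module ≤-Reasoning)
open import Data.Nat.Tactic.RingSolver using (solve-∀)
open import Data.Product using (∃-syntax; _×_; _,_; proj₁; proj₂; swap)
open import Data.Sum using (_⊎_; inj₁; inj₂; [_,_]′)
open import Data.Unit using (tt)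
open import Data.Vec using (Vec; []; _∷_; lookup; tabulate; _[_]≔_)
import Data.Vec as Vec
open import Data.Vec.Properties
  using ( lookup∘tabulate; tabulate∘lookup; tabulate-cong; lookup-map; lookup∘update; lookup∘update′
        ; lookup⇒[]=; []=⇒lookup)
import Data.Vec.Properties as Vecₚ
open import Function using (Injective; _∘_; id; _⇔_; mk⇔)
open import Function.Bundles using (Equivalence)
import Function.Properties.Equivalence as Equiv
open import Relation.Binary using (tri<; tri≈; tri>)
open import Relation.Binary.PropositionalEquality
open import Relation.Nullary using (Dec; does; ¬_; yes; no; _because_; invert)
open import Relation.Nullary.Decidable using (map′; _×-dec_; _→-dec_; dec-true; dec-false; does-⇔)

private variable m n k : ℕ

fromDoes : ∀ {A : Set} (a? : Dec A) → T (does a?) → A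
fromDoes (true because [a]) _ = invert [a]

-- Used instead of Data.Fin.Properties.all?, whose detour through decFinSubset makes the
-- exhaustive checks below several times slower to normalise.
∀? : ∀ {P : Fin n → Set} → (∀ i → Dec (P i)) → Dec (∀ i → P i)
∀? {zero} P? = yes λ ()
∀? {suc n} P? = map′ (λ { (p , h) zero → p ; (p , h) (suc i) → h i }) (λ h → h zero , h ∘ suc)
  (P? zero ×-dec ∀? (P? ∘ suc))

∀ᶠ : (Fin n → Bool) → Bool
∀ᶠ {zero} f = true
∀ᶠ {suc n} f = f zero ∧ ∀ᶠ (f ∘ suc)

∀ᶠ-sound : ∀ (f : Fin n → Bool) → T (∀ᶠ f) → ∀ i → T (f i)
∀ᶠ-sound f t zero = proj₁ (Equivalence.to T-∧ t)
∀ᶠ-sound f t (suc i) = ∀ᶠ-sound (f ∘ suc) (proj₂ (Equivalence.to T-∧ t)) i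

module Exhaustive {A : Set} (∀ᵃ : (A → Bool) → Bool)
                  (∀ᵃ-sound : ∀ f → T (∀ᵃ f) → ∀ a → T (f a)) where

  ∀ᵛ : ∀ k → (Vec A k → Bool) → Bool
  ∀ᵛ zero f = f []
  ∀ᵛ (suc k) f = ∀ᵃ λ a → ∀ᵛ k (f ∘ (a ∷_))

  ∀ᵛ-sound : ∀ k (f : Vec A k → Bool) → T (∀ᵛ k f) → ∀ v → T (f v)
  ∀ᵛ-sound zero f t [] = t
  ∀ᵛ-sound (suc k) f t (a ∷ v) = ∀ᵛ-sound k (f ∘ (a ∷_)) (∀ᵃ-sound _ t a) v

indicator : Bool → ℕ
indicator false = 0
indicator true = 1

consIf : ∀ {A : Set} → Bool → A → List A → List A
consIf p x = if p then x ∷_ else id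

length-consIf : ∀ {A : Set} p (x : A) xs → length (consIf p x xs) ≡ indicator p + length xs
length-consIf true x xs = refl
length-consIf false x xs = refl

All-consIf : ∀ {A : Set} {P : A → Set} p {x xs} → (T p → P x) → All P xs → All P (consIf p x xs)
All-consIf true Px Pxs = Px tt ∷ Pxs
All-consIf false Px Pxs = Pxs

Unique-consIf : ∀ {A : Set} p {x : A} {xs} → All (x ≢_) xs → Unique xs → Unique (consIf p x xs)
Unique-consIf true x∉ u = x∉ ∷ u
Unique-consIf false x∉ u = u

Unique-map-on : ∀ {A B : Set} {P : A → Set} (f : A → B) → (∀ {x y} → P x → P y → f x ≡ f y → x ≡ y) →
                ∀ {xs} → All P xs → Unique xs → Unique (map f xs)
Unique-map-on f inj [] [] = []
Unique-map-on f inj (px ∷ pxs) (x∉ ∷ u) =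
  Allₚ.map⁺ (All.zipWith (λ (x≢y , py) fx≡fy → x≢y (inj px py fx≡fy)) (x∉ , pxs)) ∷ Unique-map-on f inj pxs u

∣∷∣ : ∀ x (S : Subset n) → ∣ x ∷ S ∣ ≡ indicator x + ∣ S ∣
∣∷∣ false S = refl
∣∷∣ true S = refl

insert-injective : ∀ (S : Subset n) {d e} → lookup S d ≡ false → S [ d ]≔ true ≡ S [ e ]≔ true → d ≡ e
insert-injective S {d} {e} d∉ eq with d Finₚ.≟ e
... | yes d≡e = d≡e
... | no d≢e with () ← trans (sym (lookup∘update d S true))
                              (trans (cong (λ S′ → lookup S′ d) eq) (trans (lookup∘update′ d≢e S true) d∉))

⊆-insert : ∀ (S : Subset n) d → S ⊆ S [ d ]≔ true
⊆-insert S d {x} x∈ with x Finₚ.≟ d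
... | yes refl = lookup⇒[]= x _ (lookup∘update x S true)
... | no x≢d = lookup⇒[]= x _ (trans (lookup∘update′ x≢d S true) ([]=⇒lookup x∈))

∣insert∣ : ∀ (S : Subset n) d → lookup S d ≡ false → ∣ S [ d ]≔ true ∣ ≡ suc ∣ S ∣
∣insert∣ (false ∷ S) zero _ = refl
∣insert∣ (true ∷ S) (suc d) d∉ = cong suc (∣insert∣ S d d∉)
∣insert∣ (false ∷ S) (suc d) d∉ = ∣insert∣ S d d∉

-- Relative order of a family of numbers

below : (Fin m → ℕ) → ℕ → Subset m
below x a = tabulate λ j → does (x j ℕ.<? a)

∈-below⁺ : ∀ {x : Fin m → ℕ} {a j} → x j < a → j ∈ below x a
∈-below⁺ {x = x} {a} {j} xj<a =
  lookup⇒[]= j (below x a) (trans (lookup∘tabulate _ j) (dec-true (x j ℕ.<? a) xj<a))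

∈-below⁻ : ∀ {x : Fin m → ℕ} {a j} → j ∈ below x a → x j < a
∈-below⁻ {x = x} {a} {j} j∈ =
  fromDoes (x j ℕ.<? a) (Equivalence.from T-≡ (trans (sym (lookup∘tabulate _ j)) ([]=⇒lookup j∈)))

rank : (Fin m → ℕ) → Fin m → ℕ
rank x i = ∣ below x (x i) ∣

∉-below-self : ∀ (x : Fin m → ℕ) i → ¬ i ∈ below x (x i)
∉-below-self x i i∈ = <-irrefl refl (∈-below⁻ {x = x} i∈)

rank<size : ∀ (x : Fin m → ℕ) i → rank x i < m
rank<size {m} x i = subst (rank x i <_) (∣⊤∣≡n m)
  (p⊂q⇒∣p∣<∣q∣ ((λ _ → ∈⊤) , i , ∈⊤ , ∉-below-self x i))

rank-mono : ∀ (x : Fin m → ℕ) {i j} → x i < x j → rank x i < rank x j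
rank-mono x {i} xi<xj = p⊂q⇒∣p∣<∣q∣
  ((λ l∈ → ∈-below⁺ (<-trans (∈-below⁻ l∈) xi<xj)) , i , ∈-below⁺ xi<xj , ∉-below-self x i)

rank-reflects : ∀ {x : Fin m → ℕ} → Injective _≡_ _≡_ x →
                ∀ {i j} → rank x i < rank x j → x i < x j
rank-reflects {x = x} inj {i} {j} lt with <-cmp (x i) (x j)
... | tri< xi<xj _ _ = xi<xj
... | tri≈ _ xi≡xj _ with refl ← inj xi≡xj = ⊥-elim (<-irrefl refl lt)
... | tri> _ _ xj<xi = ⊥-elim (<-asym lt (rank-mono x xj<xi))

shape : (Fin m → ℕ) → Word m
shape x = tabulate λ i → fromℕ< (rank<size x i)

toℕ-shape : ∀ (x : Fin m → ℕ) i → toℕ (lookup (shape x) i) ≡ rank x i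
toℕ-shape x i = trans (cong toℕ (lookup∘tabulate _ i)) (Finₚ.toℕ-fromℕ< _)

shape-<⁺ : ∀ (x : Fin m → ℕ) {i j} → x i < x j → lookup (shape x) i Fin.< lookup (shape x) j
shape-<⁺ x {i} {j} lt = subst₂ _<_ (sym (toℕ-shape x i)) (sym (toℕ-shape x j)) (rank-mono x lt)

shape-<⁻ : ∀ {x : Fin m → ℕ} → Injective _≡_ _≡_ x →
           ∀ {i j} → lookup (shape x) i Fin.< lookup (shape x) j → x i < x j
shape-<⁻ {x = x} inj {i} {j} lt = rank-reflects inj (subst₂ _<_ (toℕ-shape x i) (toℕ-shape x j) lt)

shape-≤⁻ : ∀ (x : Fin m → ℕ) {i j} → lookup (shape x) i Fin.≤ lookup (shape x) j → x i ≤ x j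
shape-≤⁻ x le = ≮⇒≥ λ xj<xi → <⇒≱ (shape-<⁺ x xj<xi) le

shape-isPerm : ∀ {x : Fin m → ℕ} → Injective _≡_ _≡_ x → IsPerm (shape x)
shape-isPerm {x = x} inj i j eq with <-cmp (x i) (x j)
... | tri< lt _ _ = ⊥-elim (<-irrefl (cong toℕ eq) (shape-<⁺ x lt))
... | tri≈ _ e _ = inj e
... | tri> _ _ gt = ⊥-elim (<-irrefl (cong toℕ (sym eq)) (shape-<⁺ x gt))

shape-cong : ∀ {x y : Fin m → ℕ} → (∀ i j → x i < x j ⇔ y i < y j) → shape x ≡ shape y
shape-cong {x = x} {y} iff = tabulate-cong λ i →
  Finₚ.fromℕ<-cong _ _ (cong ∣_∣ (tabulate-cong λ j →
    does-⇔ (iff j i) (x j ℕ.<? x i) (y j ℕ.<? y i))) _ _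

_⊙_ : ∀ {A : Set} → Vec A m → Vec (Fin m) n → Vec A n
ρ ⊙ σ = Vec.map (lookup ρ) σ

Table : ℕ → Set
Table m = List (Vec ℕ m × Vec ℕ m)

infix 4 _↦_
_↦_ : Vec ℕ m → Vec ℕ m → Vec ℕ m × Vec ℕ m
_↦_ = _,_

image : Table m → Vec ℕ m → Vec ℕ m
image [] π = π
image ((key , val) ∷ t) π = if does (Vecₚ.≡-dec ℕ._≟_ π key) then val else image t π

indexOf : ∀ {w} → Vec ℕ (suc w) → ℕ → Fin (suc w)
indexOf {zero} _ _ = zero
indexOf {suc w} (a ∷ as) b = if a ≡ᵇ b then zero else suc (indexOf as b)

relocation : ∀ {w} → Table (suc w) → Word (suc w) → Word (suc w)
relocation t ρ = Vec.map (indexOf π) (image t π)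
  where π = Vec.map toℕ ρ

-- A table lists pairs π ↦ ψ π of window shapes in one-line notation. forward π is the
-- permutation σ of window positions with π ⊙ σ = ψ π, and backward computes σ⁻¹ from ψ π alone.
-- This module does not mention the descent patterns, so that certificates whose patterns are
-- equal but written differently are compared without unfolding the tables.
module Relocation {w : ℕ} (table : Table (suc w)) where

  forward backward : Word (suc w) → Word (suc w)
  forward = relocation table
  backward = relocation (map swap table)

  reshape : Word (suc w) → Word (suc w)
  reshape ρ = shape (toℕ ∘ lookup (ρ ⊙ forward ρ))

module Recipe {w : ℕ} (before after : Subset w) (table : Table (suc w)) where

  open Exhaustive (∀ᶠ {suc w}) ∀ᶠ-sound
  open Relocation table public

  -- σ and τ are arguments, not local definitions, so that the exhaustive check shares them.
  record SoundWith (ρ σ τ : Word (suc w)) : Set where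
    field
      σ∘τ : ∀ k → lookup σ (lookup τ k) ≡ k
      τ∘σ : ∀ k → lookup τ (lookup σ k) ≡ k
      descents : descentSet (ρ ⊙ σ) ≡ after
      inversions : ∀ i j → i Fin.< j → lookup ρ j Fin.< lookup ρ i → lookup τ i Fin.< lookup τ j
      first-rises : lookup ρ zero Fin.≤ lookup (ρ ⊙ σ) zero
      last-falls : lookup (ρ ⊙ σ) (fromℕ w) Fin.≤ lookup ρ (fromℕ w)

  soundWith? : ∀ ρ σ τ → Dec (SoundWith ρ σ τ)
  soundWith? ρ σ τ = map′ (λ (a , b , c , d , e , f) → record
      { σ∘τ = a ; τ∘σ = b ; descents = c ; inversions = d ; first-rises = e ; last-falls = f })
    (λ x → let open SoundWith x in σ∘τ , τ∘σ , descents , inversions , first-rises , last-falls)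
    (∀? (λ k → lookup σ (lookup τ k) Finₚ.≟ k) ×-dec ∀? (λ k → lookup τ (lookup σ k) Finₚ.≟ k)
    ×-dec Vecₚ.≡-dec Bool._≟_ (descentSet (ρ ⊙ σ)) after
    ×-dec ∀? (λ i → ∀? λ j →
            (i Finₚ.<? j) →-dec (lookup ρ j Finₚ.<? lookup ρ i) →-dec (lookup τ i Finₚ.<? lookup τ j))
    ×-dec lookup ρ zero Finₚ.≤? lookup (ρ ⊙ σ) zero
    ×-dec lookup (ρ ⊙ σ) (fromℕ w) Finₚ.≤? lookup ρ (fromℕ w))

  Sound : Word (suc w) → Set
  Sound ρ = SoundWith ρ (forward ρ) (backward (reshape ρ))

  inD? : ∀ ρ → Dec (InD before ρ)
  inD? ρ = ∀? (λ i → ∀? λ j → (lookup ρ i Finₚ.≟ lookup ρ j) →-dec (i Finₚ.≟ j))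
    ×-dec Vecₚ.≡-dec Bool._≟_ (descentSet ρ) before

  verdict : ∀ ρ → Dec (InD before ρ → Sound ρ)
  verdict ρ = inD? ρ →-dec soundWith? ρ (forward ρ) (backward (reshape ρ))

  checkᵇ : Bool
  checkᵇ = ∀ᵛ (suc w) (does ∘ verdict)

  Certified : Set
  Certified = ∀ ρ → InD before ρ → Sound ρ

  certify : checkᵇ ≡ true → Certified
  certify e ρ = fromDoes (verdict ρ) (∀ᵛ-sound (suc w) (does ∘ verdict) (subst T (sym e) _) ρ)

-- Lifting a rearrangement of a window to whole permutations

lookup-ext : ∀ {A : Set} (u v : Vec A n) → (∀ i → lookup u i ≡ lookup v i) → u ≡ v
lookup-ext u v h = trans (sym (tabulate∘lookup u)) (trans (tabulate-cong h) (tabulate∘lookup v))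

descent-≡ : ∀ (u : Word (suc n)) j →
            lookup (descentSet u) j ≡ does (lookup u (suc j) Fin.<? lookup u (inject₁ j))
descent-≡ u j = lookup∘tabulate _ j

-- φ v keeps v outside the letters s, …, s + w and rearranges those letters by forward of their
-- shape; the shape of the rearranged window determines backward, which undoes it.
module Lift {w : ℕ} {before after : Subset w} {table : Table (suc w)}
  (certified : Recipe.Certified before after table)
  {r : ℕ} (T S : Subset r) (s : ℕ) (in-range : s + w ≤ r)
  (window-T : ∀ k j → toℕ j ≡ s + toℕ k → lookup T j ≡ lookup before k)
  (window-S : ∀ k j → toℕ j ≡ s + toℕ k → lookup S j ≡ lookup after k)
  (left-end : ∀ j → suc (toℕ j) ≡ s → lookup T j ≡ false × lookup S j ≡ false)
  (right-end : ∀ j → toℕ j ≡ s + w → lookup T j ≡ false × lookup S j ≡ false)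
  (elsewhere : ∀ j → suc (toℕ j) < s ⊎ s + w < toℕ j → lookup S j ≡ lookup T j)
  where

  open Recipe before after table

  slot : Fin (suc w) → Fin (suc r)
  slot k = fromℕ< (s≤s (≤-trans (+-monoʳ-≤ s (Finₚ.toℕ≤pred[n] k)) in-range))

  toℕ-slot : ∀ k → toℕ (slot k) ≡ s + toℕ k
  toℕ-slot k = Finₚ.toℕ-fromℕ< _

  slot-injective : ∀ {k l} → slot k ≡ slot l → k ≡ l
  slot-injective {k} {l} eq = Finₚ.toℕ-injective
    (+-cancelˡ-≡ s _ _ (trans (sym (toℕ-slot k)) (trans (cong toℕ eq) (toℕ-slot l))))

  slot-mono : ∀ {k l} → k Fin.< l → slot k Fin.< slot l
  slot-mono {k} {l} lt = subst₂ _<_ (sym (toℕ-slot k)) (sym (toℕ-slot l)) (+-monoʳ-< s lt)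

  slot-reflects : ∀ {k l} → slot k Fin.< slot l → k Fin.< l
  slot-reflects {k} {l} lt = +-cancelˡ-< s _ _ (subst₂ _<_ (toℕ-slot k) (toℕ-slot l) lt)

  s≤slot : ∀ k → s ≤ toℕ (slot k)
  s≤slot k = subst (s ≤_) (sym (toℕ-slot k)) (m≤m+n s _)

  slot<end : ∀ k → toℕ (slot k) < s + suc w
  slot<end k = subst (_< s + suc w) (sym (toℕ-slot k)) (+-monoʳ-< s (Finₚ.toℕ<n k))

  data Region (p : Fin (suc r)) : Set where
    left : toℕ p < s → Region p
    inner : ∀ k → p ≡ slot k → Region p
    right : s + suc w ≤ toℕ p → Region p

  region : ∀ p → Region p
  region p with toℕ p ℕ.<? s
  ... | yes p<s = left p<s
  ... | no p≮s with toℕ p ∸ s ℕ.<? suc w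
  ...   | yes d<m = inner (fromℕ< d<m) (Finₚ.toℕ-injective (begin
          toℕ p                     ≡⟨ m+[n∸m]≡n (≮⇒≥ p≮s) ⟨
          s + (toℕ p ∸ s)           ≡⟨ cong (s +_) (Finₚ.toℕ-fromℕ< d<m) ⟨
          s + toℕ (fromℕ< d<m)      ≡⟨ toℕ-slot _ ⟨
          toℕ (slot (fromℕ< d<m))   ∎))
    where open ≡-Reasoning
  ...   | no d≮m = right (subst (s + suc w ≤_) (m+[n∸m]≡n (≮⇒≥ p≮s)) (+-monoʳ-≤ s (≮⇒≥ d≮m)))

  shuffle : Word (suc w) → Fin (suc r) → Fin (suc r)
  shuffle σ p with region p
  ... | left _ = p
  ... | inner k _ = slot (lookup σ k)
  ... | right _ = p

  shuffle-slot : ∀ σ k → shuffle σ (slot k) ≡ slot (lookup σ k)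
  shuffle-slot σ k with region (slot k)
  ... | left lt = ⊥-elim (<⇒≱ lt (s≤slot k))
  ... | inner l eq rewrite slot-injective eq = refl
  ... | right ge = ⊥-elim (<⇒≱ (slot<end k) ge)

  shuffle-left : ∀ σ p → toℕ p < s → shuffle σ p ≡ p
  shuffle-left σ p lt with region p
  ... | left _ = refl
  ... | inner k refl = ⊥-elim (<⇒≱ lt (s≤slot k))
  ... | right _ = refl

  shuffle-right : ∀ σ p → s + suc w ≤ toℕ p → shuffle σ p ≡ p
  shuffle-right σ p ge with region p
  ... | left _ = refl
  ... | inner k refl = ⊥-elim (<⇒≱ (slot<end k) ge)
  ... | right _ = refl

  shuffle-inverse : ∀ σ τ → (∀ k → lookup σ (lookup τ k) ≡ k) → ∀ p → shuffle σ (shuffle τ p) ≡ p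
  shuffle-inverse σ τ inv p = by-region p (region p)
    where
    by-region : ∀ p → Region p → shuffle σ (shuffle τ p) ≡ p
    by-region p (left lt) = trans (cong (shuffle σ) (shuffle-left τ p lt)) (shuffle-left σ p lt)
    by-region _ (inner k refl) =
      trans (cong (shuffle σ) (shuffle-slot τ k)) (trans (shuffle-slot σ _) (cong slot (inv k)))
    by-region p (right ge) = trans (cong (shuffle σ) (shuffle-right τ p ge)) (shuffle-right σ p ge)

  window : Word (suc r) → Fin (suc w) → ℕ
  window v k = toℕ (lookup v (slot k))

  window-injective : ∀ {v} → IsPerm v → Injective _≡_ _≡_ (window v)
  window-injective perm eq = slot-injective (perm _ _ (Finₚ.toℕ-injective eq))

  φ : Word (suc r) → Word (suc r)
  φ v = tabulate (lookup v ∘ shuffle (forward (shape (window v))))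

  gap : Fin w → Fin r
  gap k = fromℕ< (<-≤-trans (+-monoʳ-< s (Finₚ.toℕ<n k)) in-range)

  toℕ-gap : ∀ k → toℕ (gap k) ≡ s + toℕ k
  toℕ-gap k = Finₚ.toℕ-fromℕ< _

  gap-unique : ∀ {j k} → toℕ j ≡ s + toℕ k → j ≡ gap k
  gap-unique {j} {k} eq = Finₚ.toℕ-injective (trans eq (sym (toℕ-gap k)))

  suc-gap : ∀ k → suc (gap k) ≡ slot (suc k)
  suc-gap k = Finₚ.toℕ-injective
    (trans (cong suc (toℕ-gap k)) (trans (sym (+-suc s (toℕ k))) (sym (toℕ-slot (suc k)))))

  inject₁-gap : ∀ k → inject₁ (gap k) ≡ slot (inject₁ k)
  inject₁-gap k = Finₚ.toℕ-injective (begin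
    toℕ (inject₁ (gap k))    ≡⟨ Finₚ.toℕ-inject₁ (gap k) ⟩
    toℕ (gap k)              ≡⟨ toℕ-gap k ⟩
    s + toℕ k                ≡⟨ cong (s +_) (Finₚ.toℕ-inject₁ k) ⟨
    s + toℕ (inject₁ k)      ≡⟨ toℕ-slot (inject₁ k) ⟨
    toℕ (slot (inject₁ k))   ∎)
    where open ≡-Reasoning

  window-descents : ∀ {v} → InD T v → descentSet (shape (window v)) ≡ before
  window-descents {v} (perm , v-descents) = lookup-ext _ _ λ k → begin
    lookup (descentSet ρ) k
      ≡⟨ descent-≡ ρ k ⟩
    does (lookup ρ (suc k) Fin.<? lookup ρ (inject₁ k))
      ≡⟨ does-⇔ (mk⇔ (at-gap k ∘ shape-<⁻ (window-injective {v} perm)) (shape-<⁺ (window v) ∘ at-slots k))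
                (lookup ρ (suc k) Fin.<? lookup ρ (inject₁ k))
                (lookup v (suc (gap k)) Fin.<? lookup v (inject₁ (gap k))) ⟩
    does (lookup v (suc (gap k)) Fin.<? lookup v (inject₁ (gap k)))
      ≡⟨ descent-≡ v (gap k) ⟨
    lookup (descentSet v) (gap k)
      ≡⟨ cong (λ D → lookup D (gap k)) v-descents ⟩
    lookup T (gap k)
      ≡⟨ window-T k (gap k) (toℕ-gap k) ⟩
    lookup before k ∎
    where
    open ≡-Reasoning
    ρ = shape (window v)
    at-gap : ∀ k → lookup v (slot (suc k)) Fin.< lookup v (slot (inject₁ k)) →
             lookup v (suc (gap k)) Fin.< lookup v (inject₁ (gap k))
    at-gap k = subst₂ (λ a b → lookup v a Fin.< lookup v b) (sym (suc-gap k)) (sym (inject₁-gap k))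
    at-slots : ∀ k → lookup v (suc (gap k)) Fin.< lookup v (inject₁ (gap k)) →
               lookup v (slot (suc k)) Fin.< lookup v (slot (inject₁ k))
    at-slots k = subst₂ (λ a b → lookup v a Fin.< lookup v b) (suc-gap k) (inject₁-gap k)

  valid : ∀ {v} → InD T v → InD before (shape (window v))
  valid {v} v∈ = shape-isPerm (window-injective {v} (proj₁ v∈)) , window-descents {v} v∈

  data Place (j : Fin r) : Set where
    far-left : suc (toℕ j) < s → Place j
    left-edge : suc (toℕ j) ≡ s → Place j
    inside : ∀ k → j ≡ gap k → Place j
    right-edge : toℕ j ≡ s + w → Place j
    far-right : s + w < toℕ j → Place j

  place : ∀ j → Place j
  place j with <-cmp (suc (toℕ j)) s
  ... | tri< lt _ _ = far-left lt
  ... | tri≈ _ eq _ = left-edge eq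
  ... | tri> _ _ gt with <-cmp (toℕ j) (s + w)
  ...   | tri< lt _ _ = inside (fromℕ< offset<w) (gap-unique (begin
          toℕ j                        ≡⟨ m+[n∸m]≡n s≤j ⟨
          s + (toℕ j ∸ s)              ≡⟨ cong (s +_) (Finₚ.toℕ-fromℕ< offset<w) ⟨
          s + toℕ (fromℕ< offset<w)    ∎))
    where
    open ≡-Reasoning
    s≤j : s ≤ toℕ j
    s≤j = ℕ.s≤s⁻¹ gt
    offset<w : toℕ j ∸ s < w
    offset<w = +-cancelˡ-< s _ _ (subst (_< s + w) (sym (m+[n∸m]≡n s≤j)) lt)
  ...   | tri≈ _ eq _ = right-edge eq
  ...   | tri> _ _ gt′ = far-right gt′

  module Rearranged {v : Word (suc r)} (v∈ : InD T v) where

    ρ = shape (window v)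
    σ = forward ρ
    τ = backward (reshape ρ)

    open SoundWith (certified ρ (valid {v} v∈))

    ρ⊙σ : ∀ k → lookup (ρ ⊙ σ) k ≡ lookup ρ (lookup σ k)
    ρ⊙σ k = lookup-map k (lookup ρ) σ

    ρσ-<⇔ : ∀ a b → lookup (ρ ⊙ σ) a Fin.< lookup (ρ ⊙ σ) b ⇔ window v (lookup σ a) < window v (lookup σ b)
    ρσ-<⇔ a b = subst₂ (λ x y → (x Fin.< y) ⇔ (window v (lookup σ a) < window v (lookup σ b)))
                       (sym (ρ⊙σ a)) (sym (ρ⊙σ b))
      (mk⇔ (shape-<⁻ (window-injective {v} (proj₁ v∈))) (shape-<⁺ (window v)))

    ρσ-≤ : ∀ a b → lookup (ρ ⊙ σ) a Fin.≤ lookup ρ b → window v (lookup σ a) ≤ window v b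
    ρσ-≤ a b le = shape-≤⁻ (window v) (subst (Fin._≤ lookup ρ b) (ρ⊙σ a) le)

    ρ-≤σ : ∀ a b → lookup ρ a Fin.≤ lookup (ρ ⊙ σ) b → window v a ≤ window v (lookup σ b)
    ρ-≤σ a b le = shape-≤⁻ (window v) (subst (lookup ρ a Fin.≤_) (ρ⊙σ b) le)

    φ-at : ∀ p → lookup (φ v) p ≡ lookup v (shuffle σ p)
    φ-at p = lookup∘tabulate (lookup v ∘ shuffle σ) p

    window-φ : ∀ k → window (φ v) k ≡ window v (lookup σ k)
    window-φ k = cong toℕ (trans (φ-at (slot k)) (cong (lookup v) (shuffle-slot σ k)))

    reshape-φ : shape (window (φ v)) ≡ reshape ρ
    reshape-φ = shape-cong λ i j →
      subst₂ (λ a b → (a < b) ⇔ (toℕ (lookup (ρ ⊙ σ) i) < toℕ (lookup (ρ ⊙ σ) j)))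
             (sym (window-φ i)) (sym (window-φ j)) (Equiv.sym (ρσ-<⇔ i j))

    restore : ∀ p → lookup (φ v) (shuffle τ p) ≡ lookup v p
    restore p = trans (φ-at _) (cong (lookup v) (shuffle-inverse σ τ σ∘τ p))

    φ-isPerm : IsPerm (φ v)
    φ-isPerm p q eq = begin
      p                          ≡⟨ shuffle-inverse τ σ τ∘σ p ⟨
      shuffle τ (shuffle σ p)    ≡⟨ cong (shuffle τ) (proj₁ v∈ _ _ (trans (sym (φ-at p)) (trans eq (φ-at q)))) ⟩
      shuffle τ (shuffle σ q)    ≡⟨ shuffle-inverse τ σ τ∘σ q ⟩
      q                          ∎
      where open ≡-Reasoning

    v-descent : ∀ j → does (lookup v (suc j) Fin.<? lookup v (inject₁ j)) ≡ lookup T j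
    v-descent j = trans (sym (descent-≡ v j)) (cong (λ D → lookup D j) (proj₂ v∈))

    ascent : ∀ {j} → lookup T j ≡ false → lookup v (inject₁ j) Fin.≤ lookup v (suc j)
    ascent {j} Tj = ≮⇒≥ λ lt →
      true≢false (trans (sym (dec-true (lookup v (suc j) Fin.<? lookup v (inject₁ j)) lt))
                        (trans (v-descent j) Tj))
      where
      true≢false : true ≡ false → ⊥
      true≢false ()

    φ-descent-≡ : ∀ j → lookup (descentSet (φ v)) j ≡
                  does (lookup v (shuffle σ (suc j)) Fin.<? lookup v (shuffle σ (inject₁ j)))
    φ-descent-≡ j =
      trans (descent-≡ (φ v) j) (cong₂ (λ a b → does (a Fin.<? b)) (φ-at (suc j)) (φ-at (inject₁ j)))

    descent-outside : ∀ j → shuffle σ (suc j) ≡ suc j → shuffle σ (inject₁ j) ≡ inject₁ j →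
                      lookup S j ≡ lookup T j → lookup (descentSet (φ v)) j ≡ lookup S j
    descent-outside j fixes-suc fixes-inject S≡T = begin
      lookup (descentSet (φ v)) j
        ≡⟨ φ-descent-≡ j ⟩
      does (lookup v (shuffle σ (suc j)) Fin.<? lookup v (shuffle σ (inject₁ j)))
        ≡⟨ cong₂ (λ a b → does (lookup v a Fin.<? lookup v b)) fixes-suc fixes-inject ⟩
      does (lookup v (suc j) Fin.<? lookup v (inject₁ j))
        ≡⟨ v-descent j ⟩
      lookup T j
        ≡⟨ S≡T ⟨
      lookup S j ∎
      where open ≡-Reasoning

    descent-inside : ∀ k → lookup (descentSet (φ v)) (gap k) ≡ lookup S (gap k)
    descent-inside k = begin
      lookup (descentSet (φ v)) (gap k)
        ≡⟨ φ-descent-≡ (gap k) ⟩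
      does (lookup v (shuffle σ (suc (gap k))) Fin.<? lookup v (shuffle σ (inject₁ (gap k))))
        ≡⟨ cong₂ (λ a b → does (lookup v a Fin.<? lookup v b))
                 (trans (cong (shuffle σ) (suc-gap k)) (shuffle-slot σ _))
                 (trans (cong (shuffle σ) (inject₁-gap k)) (shuffle-slot σ _)) ⟩
      does (lookup v (slot (lookup σ (suc k))) Fin.<? lookup v (slot (lookup σ (inject₁ k))))
        ≡⟨ does-⇔ (ρσ-<⇔ (suc k) (inject₁ k)) (lookup (ρ ⊙ σ) (suc k) Fin.<? lookup (ρ ⊙ σ) (inject₁ k))
                   (lookup v (slot (lookup σ (suc k))) Fin.<? lookup v (slot (lookup σ (inject₁ k)))) ⟨
      does (lookup (ρ ⊙ σ) (suc k) Fin.<? lookup (ρ ⊙ σ) (inject₁ k))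
        ≡⟨ descent-≡ (ρ ⊙ σ) k ⟨
      lookup (descentSet (ρ ⊙ σ)) k
        ≡⟨ cong (λ D → lookup D k) descents ⟩
      lookup after k
        ≡⟨ window-S k (gap k) (toℕ-gap k) ⟨
      lookup S (gap k) ∎
      where open ≡-Reasoning

    no-descent : ∀ j → ¬ (lookup v (shuffle σ (suc j)) Fin.< lookup v (shuffle σ (inject₁ j))) →
                 lookup S j ≡ false → lookup (descentSet (φ v)) j ≡ lookup S j
    no-descent j ¬lt Sj = trans (φ-descent-≡ j)
      (trans (dec-false (lookup v (shuffle σ (suc j)) Fin.<? lookup v (shuffle σ (inject₁ j))) ¬lt) (sym Sj))

    rises-at-left-edge : ∀ j → suc (toℕ j) ≡ s →
                         ¬ (lookup v (shuffle σ (suc j)) Fin.< lookup v (shuffle σ (inject₁ j)))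
    rises-at-left-edge j eq lt = <⇒≱
      (subst₂ (λ a b → lookup v a Fin.< lookup v b)
              (trans (cong (shuffle σ) first) (shuffle-slot σ zero)) (shuffle-left σ _ j<s) lt)
      (≤-trans (subst (λ a → lookup v (inject₁ j) Fin.≤ lookup v a) first (ascent (proj₁ (left-end j eq))))
               (ρ-≤σ zero zero first-rises))
      where
      first : suc j ≡ slot zero
      first = Finₚ.toℕ-injective (trans eq (trans (sym (+-identityʳ s)) (sym (toℕ-slot zero))))
      j<s : toℕ (inject₁ j) < s
      j<s = subst (_< s) (sym (Finₚ.toℕ-inject₁ j)) (subst (toℕ j <_) eq (n<1+n _))

    falls-at-right-edge : ∀ j → toℕ j ≡ s + w →
                          ¬ (lookup v (shuffle σ (suc j)) Fin.< lookup v (shuffle σ (inject₁ j)))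
    falls-at-right-edge j eq lt = <⇒≱
      (subst₂ (λ a b → lookup v a Fin.< lookup v b)
              (shuffle-right σ _ end≤j) (trans (cong (shuffle σ) last) (shuffle-slot σ _)) lt)
      (≤-trans (ρσ-≤ (fromℕ w) (fromℕ w) last-falls)
               (subst (λ a → lookup v a Fin.≤ lookup v (suc j)) last (ascent (proj₁ (right-end j eq)))))
      where
      last : inject₁ j ≡ slot (fromℕ w)
      last = Finₚ.toℕ-injective (trans (Finₚ.toℕ-inject₁ j)
               (trans eq (trans (cong (s +_) (sym (Finₚ.toℕ-fromℕ w))) (sym (toℕ-slot (fromℕ w))))))
      end≤j : s + suc w ≤ toℕ (suc j)
      end≤j = subst (_≤ suc (toℕ j)) (sym (+-suc s w)) (s≤s (≤-reflexive (sym eq)))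

    φ-descent : ∀ j → Place j → lookup (descentSet (φ v)) j ≡ lookup S j
    φ-descent j (far-left lt) =
      descent-outside j (shuffle-left σ (suc j) lt) (shuffle-left σ (inject₁ j) j<s) (elsewhere j (inj₁ lt))
      where
      j<s : toℕ (inject₁ j) < s
      j<s = subst (_< s) (sym (Finₚ.toℕ-inject₁ j)) (<-trans (n<1+n _) lt)
    φ-descent j (left-edge eq) = no-descent j (rises-at-left-edge j eq) (proj₂ (left-end j eq))
    φ-descent _ (inside k refl) = descent-inside k
    φ-descent j (right-edge eq) = no-descent j (falls-at-right-edge j eq) (proj₂ (right-end j eq))
    φ-descent j (far-right gt) =
      descent-outside j (shuffle-right σ (suc j) (m≤n⇒m≤1+n end≤j)) (shuffle-right σ (inject₁ j) end≤j′)
                      (elsewhere j (inj₂ gt))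
      where
      end≤j : s + suc w ≤ toℕ j
      end≤j = subst (_≤ toℕ j) (sym (+-suc s w)) gt
      end≤j′ : s + suc w ≤ toℕ (inject₁ j)
      end≤j′ = subst (s + suc w ≤_) (sym (Finₚ.toℕ-inject₁ j)) end≤j

    φ-descents : descentSet (φ v) ≡ S
    φ-descents = lookup-ext _ _ λ j → φ-descent j (place j)

    keeps-order : ∀ p q → p Fin.< q → lookup v q Fin.< lookup v p → shuffle τ p Fin.< shuffle τ q
    keeps-order p q = by-regions p q (region p) (region q)
      where
      by-regions : ∀ p q → Region p → Region q →
                   p Fin.< q → lookup v q Fin.< lookup v p → shuffle τ p Fin.< shuffle τ q
      by-regions p q (left a) (left b) p<q _ =
        subst₂ Fin._<_ (sym (shuffle-left τ p a)) (sym (shuffle-left τ q b)) p<q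
      by-regions p _ (left a) (inner l refl) _ _ =
        subst₂ Fin._<_ (sym (shuffle-left τ p a)) (sym (shuffle-slot τ l)) (<-≤-trans a (s≤slot _))
      by-regions p q (left a) (right b) p<q _ =
        subst₂ Fin._<_ (sym (shuffle-left τ p a)) (sym (shuffle-right τ q b)) p<q
      by-regions _ q (inner k refl) (left b) p<q _ = ⊥-elim (<⇒≱ (<-trans p<q b) (s≤slot k))
      by-regions _ _ (inner k refl) (inner l refl) p<q vq<vp =
        subst₂ Fin._<_ (sym (shuffle-slot τ k)) (sym (shuffle-slot τ l))
          (slot-mono (inversions k l (slot-reflects p<q) (shape-<⁺ (window v) vq<vp)))
      by-regions _ q (inner k refl) (right b) _ _ =
        subst₂ Fin._<_ (sym (shuffle-slot τ k)) (sym (shuffle-right τ q b)) (<-≤-trans (slot<end _) b)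
      by-regions p q (right a) (left b) p<q _ = ⊥-elim (<⇒≱ (<-trans p<q (<-≤-trans b (m≤m+n s _))) a)
      by-regions p _ (right a) (inner l refl) p<q _ = ⊥-elim (<⇒≱ (<-trans p<q (slot<end l)) a)
      by-regions p q (right a) (right b) p<q _ =
        subst₂ Fin._<_ (sym (shuffle-right τ p a)) (sym (shuffle-right τ q b)) p<q

    φ-above : v ≤w φ v
    φ-above _ _ (p , q , p<q , refl , refl , b<a) =
      shuffle τ p , shuffle τ q , keeps-order p q p<q b<a , restore p , restore q , b<a

  φ-injective : ∀ v v′ (v∈ : InD T v) (v′∈ : InD T v′) → φ v ≡ φ v′ → v ≡ v′
  φ-injective v v′ v∈ v′∈ eq = lookup-ext v v′ λ p → begin
    lookup v p                        ≡⟨ M.restore p ⟨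
    lookup (φ v) (shuffle M.τ p)      ≡⟨ cong₂ (λ u τ → lookup u (shuffle τ p)) eq same-τ ⟩
    lookup (φ v′) (shuffle M′.τ p)    ≡⟨ M′.restore p ⟩
    lookup v′ p                       ∎
    where
    open ≡-Reasoning
    module M = Rearranged {v} v∈
    module M′ = Rearranged {v′} v′∈
    same-τ : M.τ ≡ M′.τ
    same-τ = cong backward (trans (sym M.reshape-φ) (trans (cong (shape ∘ window) eq) M′.reshape-φ))

  dominates : Dominates S T
  dominates =
    (λ v _ → φ v) ,
    (λ v v∈ → Rearranged.φ-isPerm {v} v∈ , Rearranged.φ-descents {v} v∈) ,
    φ-injective ,
    λ v v∈ → Rearranged.φ-above {v} v∈

record Fits (bs : Subset k) (S : Subset n) (s : ℕ) : Set where
  field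
    in-range : s + k ≤ n
    window : ∀ i j → toℕ j ≡ s + toℕ i → lookup S j ≡ lookup bs i
    left-edge : ∀ j → suc (toℕ j) ≡ s → lookup S j ≡ false
    right-edge : ∀ j → toℕ j ≡ s + k → lookup S j ≡ false

module _ {w : ℕ} {before : Subset w} {spot : Fin w} {table : Table (suc w)}
  (certified : Recipe.Certified before (before [ spot ]≔ true) table) where

  insertion-dominates : ∀ {r} {S : Subset r} {s} → Fits before S s →
                        ∀ d → toℕ d ≡ s + toℕ spot → Dominates (S [ d ]≔ true) S
  insertion-dominates {S = S} {s} fits d d≡ =
    Lift.dominates certified S (S [ d ]≔ true) s in-range window window-S
      (λ j eq → left-edge j eq , trans (other j (left≢ j eq)) (left-edge j eq))
      (λ j eq → right-edge j eq , trans (other j (right≢ j eq)) (right-edge j eq))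
      (λ j far → other j (far≢ j far))
    where
    open Fits fits
    other : ∀ j → toℕ j ≢ toℕ d → lookup (S [ d ]≔ true) j ≡ lookup S j
    other j j≢d = lookup∘update′ (j≢d ∘ cong toℕ) S true
    left≢ : ∀ j → suc (toℕ j) ≡ s → toℕ j ≢ toℕ d
    left≢ j eq j≡d = <-irrefl (trans j≡d d≡) (<-≤-trans (subst (toℕ j <_) eq (n<1+n _)) (m≤m+n s _))
    right≢ : ∀ j → toℕ j ≡ s + w → toℕ j ≢ toℕ d
    right≢ j eq j≡d = <-irrefl (sym (trans (sym eq) (trans j≡d d≡))) (+-monoʳ-< s (Finₚ.toℕ<n spot))
    far≢ : ∀ j → suc (toℕ j) < s ⊎ s + w < toℕ j → toℕ j ≢ toℕ d
    far≢ j (inj₁ lt) j≡d = <⇒≱ (<-trans (n<1+n _) lt) (subst (s ≤_) (sym (trans j≡d d≡)) (m≤m+n s _))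
    far≢ j (inj₂ gt) j≡d = <⇒≱ (<-trans (+-monoʳ-< s (Finₚ.toℕ<n spot)) gt) (≤-reflexive (trans j≡d d≡))
    window-S : ∀ i j → toℕ j ≡ s + toℕ i → lookup (S [ d ]≔ true) j ≡ lookup (before [ spot ]≔ true) i
    window-S i j eq with i Finₚ.≟ spot
    ... | yes refl = trans (cong (lookup (S [ d ]≔ true)) (Finₚ.toℕ-injective (trans eq (sym d≡))))
                           (trans (lookup∘update d S true) (sym (lookup∘update spot before true)))
    ... | no i≢spot = trans
      (other j λ j≡d → i≢spot (Finₚ.toℕ-injective (+-cancelˡ-≡ s _ _ (trans (sym eq) (trans j≡d d≡)))))
      (trans (window i j eq) (sym (lookup∘update′ i≢spot before true)))

-- Descent words as sequences of cells

data Cell : Set where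
  out asc des : Cell

cell : Bool → Cell
cell false = asc
cell true = des

cell-injective : ∀ {a b} → cell a ≡ cell b → a ≡ b
cell-injective {false} {false} _ = refl
cell-injective {true} {true} _ = refl

cell≢out : ∀ b → cell b ≢ out
cell≢out false ()
cell≢out true ()

free : Cell → Bool
free des = false
free _ = true

free-sound : ∀ c → T (free c) → c ≢ des
free-sound out _ ()
free-sound asc _ ()

shows : Bool → Cell → Bool
shows false asc = true
shows true des = true
shows _ _ = false

shows-sound : ∀ b c → T (shows b c) → c ≡ cell b
shows-sound false asc _ = refl
shows-sound true des _ = refl

matchesᵇ : Vec Bool k → (ℕ → Cell) → Bool
matchesᵇ [] u = true
matchesᵇ (b ∷ bs) u = shows b (u 0) ∧ matchesᵇ bs (u ∘ suc)

matchesᵇ-sound : ∀ (bs : Vec Bool k) u → T (matchesᵇ bs u) → ∀ i → u (toℕ i) ≡ cell (lookup bs i)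
matchesᵇ-sound (b ∷ bs) u t zero = shows-sound b (u 0) (proj₁ (Equivalence.to T-∧ t))
matchesᵇ-sound (b ∷ bs) u t (suc i) = matchesᵇ-sound bs (u ∘ suc) (proj₂ (Equivalence.to T-∧ t)) i

matchesᵇ-cong : ∀ (bs : Vec Bool k) {u u′} → (∀ i → u i ≡ u′ i) → matchesᵇ bs u ≡ matchesᵇ bs u′
matchesᵇ-cong [] eq = refl
matchesᵇ-cong (b ∷ bs) eq = cong₂ _∧_ (cong (shows b) (eq 0)) (matchesᵇ-cong bs (eq ∘ suc))

fitsᵇ : Vec Bool k → (ℕ → Cell) → Bool
fitsᵇ {k} bs u = free (u 0) ∧ matchesᵇ bs (u ∘ suc) ∧ free (u (suc k))

fitsᵇ-cong : ∀ (bs : Vec Bool k) {u u′} → (∀ i → u i ≡ u′ i) → fitsᵇ bs u ≡ fitsᵇ bs u′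
fitsᵇ-cong {k} bs eq =
  cong₂ _∧_ (cong free (eq 0)) (cong₂ _∧_ (matchesᵇ-cong bs (eq ∘ suc)) (cong free (eq (suc k))))

shift : ℕ → (ℕ → Cell) → ℕ → Cell
shift q u i = u (q + i)

at : Subset n → ℕ → Cell
at [] _ = out
at (b ∷ S) zero = cell b
at (b ∷ S) (suc i) = at S i

at-lookup : ∀ (S : Subset n) j → at S (toℕ j) ≡ cell (lookup S j)
at-lookup (b ∷ S) zero = refl
at-lookup (b ∷ S) (suc j) = at-lookup S j

at-inside : ∀ (S : Subset n) i → at S i ≢ out → i < n
at-inside [] i ne = ⊥-elim (ne refl)
at-inside (b ∷ S) zero ne = s≤s z≤n
at-inside (b ∷ S) (suc i) ne = s≤s (at-inside S i ne)

framed : Cell → Cell → Cell → Subset n → ℕ → Cell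
framed a b c S 0 = a
framed a b c S 1 = b
framed a b c S 2 = c
framed a b c S (suc (suc (suc i))) = at S i

framed-step : ∀ a b c x (S : Subset n) i → framed a b c (x ∷ S) (suc i) ≡ framed b c (cell x) S i
framed-step a b c x S 0 = refl
framed-step a b c x S 1 = refl
framed-step a b c x S 2 = refl
framed-step a b c x S (suc (suc (suc i))) = refl

-- padded S p is the cell of position p − 3: out below 0 and from r on.
padded : Subset n → ℕ → Cell
padded = framed out out out

padded-low : ∀ (S : Subset n) p → p < 3 → padded S p ≡ out
padded-low S 0 _ = refl
padded-low S 1 _ = refl
padded-low S 2 _ = refl
padded-low S (suc (suc (suc p))) (s≤s (s≤s (s≤s ())))

record LocalMove : Set where
  field
    width : ℕ
    before : Subset width
    spot : Fin width
    table : Table (suc width)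
    spot-ascent : lookup before spot ≡ false
    checked : Recipe.checkᵇ before (before [ spot ]≔ true) table ≡ true

DominatingInsertion : Subset n → Fin n → Set
DominatingInsertion S d = lookup S d ≡ false × Dominates (S [ d ]≔ true) S

fitsᵇ-parts : ∀ (bs : Subset k) u → T (fitsᵇ bs u) →
             T (free (u 0)) × (∀ i → u (suc (toℕ i)) ≡ cell (lookup bs i)) × T (free (u (suc k)))
fitsᵇ-parts bs u t =
  proj₁ parts , matchesᵇ-sound bs (u ∘ suc) (proj₁ rest) , proj₂ rest
  where
  parts = Equivalence.to T-∧ t
  rest = Equivalence.to T-∧ (proj₂ parts)

at-cell : ∀ (S : Subset n) {b} j → at S (toℕ j) ≡ cell b → lookup S j ≡ b
at-cell S j eq = cell-injective (trans (sym (at-lookup S j)) eq)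

at-free : ∀ (S : Subset n) j → T (free (at S (toℕ j))) → lookup S j ≡ false
at-free S j t with lookup S j | at-lookup S j
... | false | _ = refl
... | true | eq = ⊥-elim (free-sound _ t eq)

fitsᵇ-offset : ∀ (bs : Subset k) (S : Subset n) q → 0 < k → T (fitsᵇ bs (shift q (padded S))) → 2 ≤ q
fitsᵇ-offset {suc k} bs S q _ t = ≮⇒≥ λ q<2 → cell≢out _
  (trans (sym (proj₁ (proj₂ (fitsᵇ-parts bs (shift q (padded S)) t)) zero))
  (padded-low S (q + 1) (subst (_< 3) (sym (+-comm q 1)) (s≤s q<2))))

fitsᵇ-sound : ∀ (bs : Subset k) (S : Subset n) s → 0 < k →
              T (fitsᵇ bs (shift (2 + s) (padded S))) → Fits bs S s
fitsᵇ-sound {suc k} {n} bs S s _ t = record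
  { in-range = subst (_≤ n) (sym (+-suc s k)) (at-inside S (s + k) λ eq →
      cell≢out _ (trans (sym (window-at (fromℕ k)))
                 (trans (cong (λ i → at S (s + i)) (Finₚ.toℕ-fromℕ k)) eq)))
  ; window = λ i j eq → at-cell S j (trans (cong (at S) eq) (window-at i))
  ; left-edge = λ j eq → at-free S j
      (subst (T ∘ free ∘ padded S) (cong (2 +_) (trans (+-identityʳ s) (sym eq))) left)
  ; right-edge = λ j eq → at-free S j
      (subst (T ∘ free ∘ padded S) (cong (2 +_) (trans (+-suc s (suc k)) (cong suc (sym eq)))) right)
  }
  where
  parts = fitsᵇ-parts bs (shift (2 + s) (padded S)) t
  left = proj₁ parts
  right = proj₂ (proj₂ parts)
  window-at : ∀ i → at S (s + toℕ i) ≡ cell (lookup bs i)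
  window-at i = trans (cong (λ p → padded S (2 + p)) (sym (+-suc s (toℕ i)))) (proj₁ (proj₂ parts) i)

module _ (mv : LocalMove) where
  open LocalMove mv

  fits⇒insertion : ∀ {r} (S : Subset r) q → T (fitsᵇ before (shift q (padded S))) →
                   ∀ d → toℕ d + 2 ≡ q + toℕ spot → DominatingInsertion S d
  fits⇒insertion S q t d d≡ =
    trans (Fits.window fits spot d toℕ-d) spot-ascent ,
    insertion-dominates (Recipe.certify before (before [ spot ]≔ true) table checked) fits d toℕ-d
    where
    0<width : 0 < width
    0<width = ≤-<-trans z≤n (Finₚ.toℕ<n spot)
    q≡ : q ≡ 2 + (q ∸ 2)
    q≡ = sym (m+[n∸m]≡n (fitsᵇ-offset before S q 0<width t))
    fits : Fits before S (q ∸ 2)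
    fits = fitsᵇ-sound before S (q ∸ 2) 0<width (subst (λ q → T (fitsᵇ before (shift q (padded S)))) q≡ t)
    toℕ-d : toℕ d ≡ q ∸ 2 + toℕ spot
    toℕ-d = +-cancelʳ-≡ 2 (toℕ d) (q ∸ 2 + toℕ spot)
      (trans d≡ (trans (cong (_+ toℕ spot) q≡) (+-comm 2 (q ∸ 2 + toℕ spot))))

-- The three local moves

move[0] : LocalMove
move[0] = record
  { width = 1
  ; before = false ∷ []
  ; spot = zero
  ; table = (0 ∷ 1 ∷ [] ↦ 1 ∷ 0 ∷ []) ∷ []
  ; spot-ascent = refl
  ; checked = refl
  }

table[100] : Table 4
table[100] =
  ( (1 ∷ 0 ∷ 2 ∷ 3 ∷ [] ↦ 2 ∷ 1 ∷ 0 ∷ 3 ∷ [])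
  ∷ (2 ∷ 0 ∷ 1 ∷ 3 ∷ [] ↦ 3 ∷ 2 ∷ 0 ∷ 1 ∷ [])
  ∷ (3 ∷ 0 ∷ 1 ∷ 2 ∷ [] ↦ 3 ∷ 1 ∷ 0 ∷ 2 ∷ [])
  ∷ [])

move[100] : LocalMove
move[100] = record
  { width = 3
  ; before = true ∷ false ∷ false ∷ []
  ; spot = suc zero
  ; table = table[100]
  ; spot-ascent = refl
  ; checked = refl
  }

table[01001] : Table 6
table[01001] =
  ( (0 ∷ 2 ∷ 1 ∷ 3 ∷ 5 ∷ 4 ∷ [] ↦ 0 ∷ 3 ∷ 2 ∷ 1 ∷ 5 ∷ 4 ∷ [])
  ∷ (0 ∷ 2 ∷ 1 ∷ 4 ∷ 5 ∷ 3 ∷ [] ↦ 0 ∷ 4 ∷ 2 ∷ 1 ∷ 5 ∷ 3 ∷ [])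
  ∷ (0 ∷ 3 ∷ 1 ∷ 2 ∷ 5 ∷ 4 ∷ [] ↦ 0 ∷ 5 ∷ 3 ∷ 2 ∷ 4 ∷ 1 ∷ [])
  ∷ (0 ∷ 3 ∷ 1 ∷ 4 ∷ 5 ∷ 2 ∷ [] ↦ 0 ∷ 4 ∷ 3 ∷ 1 ∷ 5 ∷ 2 ∷ [])
  ∷ (0 ∷ 3 ∷ 2 ∷ 4 ∷ 5 ∷ 1 ∷ [] ↦ 0 ∷ 4 ∷ 3 ∷ 2 ∷ 5 ∷ 1 ∷ [])
  ∷ (0 ∷ 4 ∷ 1 ∷ 2 ∷ 5 ∷ 3 ∷ [] ↦ 4 ∷ 5 ∷ 3 ∷ 1 ∷ 2 ∷ 0 ∷ [])
  ∷ (0 ∷ 4 ∷ 1 ∷ 3 ∷ 5 ∷ 2 ∷ [] ↦ 0 ∷ 5 ∷ 4 ∷ 1 ∷ 3 ∷ 2 ∷ [])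
  ∷ (0 ∷ 4 ∷ 2 ∷ 3 ∷ 5 ∷ 1 ∷ [] ↦ 4 ∷ 5 ∷ 2 ∷ 0 ∷ 3 ∷ 1 ∷ [])
  ∷ (0 ∷ 5 ∷ 1 ∷ 2 ∷ 4 ∷ 3 ∷ [] ↦ 0 ∷ 5 ∷ 2 ∷ 1 ∷ 4 ∷ 3 ∷ [])
  ∷ (0 ∷ 5 ∷ 1 ∷ 3 ∷ 4 ∷ 2 ∷ [] ↦ 0 ∷ 5 ∷ 3 ∷ 1 ∷ 4 ∷ 2 ∷ [])
  ∷ (0 ∷ 5 ∷ 2 ∷ 3 ∷ 4 ∷ 1 ∷ [] ↦ 0 ∷ 5 ∷ 4 ∷ 2 ∷ 3 ∷ 1 ∷ [])
  ∷ (1 ∷ 2 ∷ 0 ∷ 3 ∷ 5 ∷ 4 ∷ [] ↦ 2 ∷ 3 ∷ 1 ∷ 0 ∷ 5 ∷ 4 ∷ [])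
  ∷ (1 ∷ 2 ∷ 0 ∷ 4 ∷ 5 ∷ 3 ∷ [] ↦ 1 ∷ 5 ∷ 2 ∷ 0 ∷ 4 ∷ 3 ∷ [])
  ∷ (1 ∷ 3 ∷ 0 ∷ 2 ∷ 5 ∷ 4 ∷ [] ↦ 1 ∷ 3 ∷ 2 ∷ 0 ∷ 5 ∷ 4 ∷ [])
  ∷ (1 ∷ 3 ∷ 0 ∷ 4 ∷ 5 ∷ 2 ∷ [] ↦ 3 ∷ 5 ∷ 1 ∷ 0 ∷ 4 ∷ 2 ∷ [])
  ∷ (1 ∷ 3 ∷ 2 ∷ 4 ∷ 5 ∷ 0 ∷ [] ↦ 1 ∷ 4 ∷ 3 ∷ 2 ∷ 5 ∷ 0 ∷ [])
  ∷ (1 ∷ 4 ∷ 0 ∷ 2 ∷ 5 ∷ 3 ∷ [] ↦ 1 ∷ 4 ∷ 2 ∷ 0 ∷ 5 ∷ 3 ∷ [])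
  ∷ (1 ∷ 4 ∷ 0 ∷ 3 ∷ 5 ∷ 2 ∷ [] ↦ 1 ∷ 4 ∷ 3 ∷ 0 ∷ 5 ∷ 2 ∷ [])
  ∷ (1 ∷ 4 ∷ 2 ∷ 3 ∷ 5 ∷ 0 ∷ [] ↦ 1 ∷ 5 ∷ 4 ∷ 2 ∷ 3 ∷ 0 ∷ [])
  ∷ (1 ∷ 5 ∷ 0 ∷ 2 ∷ 4 ∷ 3 ∷ [] ↦ 1 ∷ 5 ∷ 4 ∷ 0 ∷ 3 ∷ 2 ∷ [])
  ∷ (1 ∷ 5 ∷ 0 ∷ 3 ∷ 4 ∷ 2 ∷ [] ↦ 1 ∷ 5 ∷ 3 ∷ 0 ∷ 4 ∷ 2 ∷ [])
  ∷ (1 ∷ 5 ∷ 2 ∷ 3 ∷ 4 ∷ 0 ∷ [] ↦ 1 ∷ 5 ∷ 3 ∷ 2 ∷ 4 ∷ 0 ∷ [])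
  ∷ (2 ∷ 3 ∷ 0 ∷ 1 ∷ 5 ∷ 4 ∷ [] ↦ 2 ∷ 5 ∷ 3 ∷ 0 ∷ 4 ∷ 1 ∷ [])
  ∷ (2 ∷ 3 ∷ 0 ∷ 4 ∷ 5 ∷ 1 ∷ [] ↦ 3 ∷ 4 ∷ 2 ∷ 0 ∷ 5 ∷ 1 ∷ [])
  ∷ (2 ∷ 3 ∷ 1 ∷ 4 ∷ 5 ∷ 0 ∷ [] ↦ 2 ∷ 4 ∷ 3 ∷ 1 ∷ 5 ∷ 0 ∷ [])
  ∷ (2 ∷ 4 ∷ 0 ∷ 1 ∷ 5 ∷ 3 ∷ [] ↦ 2 ∷ 4 ∷ 1 ∷ 0 ∷ 5 ∷ 3 ∷ [])
  ∷ (2 ∷ 4 ∷ 0 ∷ 3 ∷ 5 ∷ 1 ∷ [] ↦ 2 ∷ 4 ∷ 3 ∷ 0 ∷ 5 ∷ 1 ∷ [])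
  ∷ (2 ∷ 4 ∷ 1 ∷ 3 ∷ 5 ∷ 0 ∷ [] ↦ 2 ∷ 5 ∷ 4 ∷ 1 ∷ 3 ∷ 0 ∷ [])
  ∷ (2 ∷ 5 ∷ 0 ∷ 1 ∷ 4 ∷ 3 ∷ [] ↦ 2 ∷ 5 ∷ 1 ∷ 0 ∷ 4 ∷ 3 ∷ [])
  ∷ (2 ∷ 5 ∷ 0 ∷ 3 ∷ 4 ∷ 1 ∷ [] ↦ 2 ∷ 5 ∷ 4 ∷ 0 ∷ 3 ∷ 1 ∷ [])
  ∷ (2 ∷ 5 ∷ 1 ∷ 3 ∷ 4 ∷ 0 ∷ [] ↦ 2 ∷ 5 ∷ 3 ∷ 1 ∷ 4 ∷ 0 ∷ [])
  ∷ (3 ∷ 4 ∷ 0 ∷ 1 ∷ 5 ∷ 2 ∷ [] ↦ 3 ∷ 4 ∷ 1 ∷ 0 ∷ 5 ∷ 2 ∷ [])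
  ∷ (3 ∷ 4 ∷ 0 ∷ 2 ∷ 5 ∷ 1 ∷ [] ↦ 3 ∷ 5 ∷ 4 ∷ 0 ∷ 2 ∷ 1 ∷ [])
  ∷ (3 ∷ 4 ∷ 1 ∷ 2 ∷ 5 ∷ 0 ∷ [] ↦ 3 ∷ 4 ∷ 2 ∷ 1 ∷ 5 ∷ 0 ∷ [])
  ∷ (3 ∷ 5 ∷ 0 ∷ 1 ∷ 4 ∷ 2 ∷ [] ↦ 3 ∷ 5 ∷ 4 ∷ 1 ∷ 2 ∷ 0 ∷ [])
  ∷ (3 ∷ 5 ∷ 0 ∷ 2 ∷ 4 ∷ 1 ∷ [] ↦ 3 ∷ 5 ∷ 2 ∷ 0 ∷ 4 ∷ 1 ∷ [])
  ∷ (3 ∷ 5 ∷ 1 ∷ 2 ∷ 4 ∷ 0 ∷ [] ↦ 3 ∷ 5 ∷ 2 ∷ 1 ∷ 4 ∷ 0 ∷ [])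
  ∷ (4 ∷ 5 ∷ 0 ∷ 1 ∷ 3 ∷ 2 ∷ [] ↦ 4 ∷ 5 ∷ 1 ∷ 0 ∷ 3 ∷ 2 ∷ [])
  ∷ (4 ∷ 5 ∷ 0 ∷ 2 ∷ 3 ∷ 1 ∷ [] ↦ 4 ∷ 5 ∷ 3 ∷ 0 ∷ 2 ∷ 1 ∷ [])
  ∷ (4 ∷ 5 ∷ 1 ∷ 2 ∷ 3 ∷ 0 ∷ [] ↦ 4 ∷ 5 ∷ 2 ∷ 1 ∷ 3 ∷ 0 ∷ [])
  ∷ [])

move[01001] : LocalMove
move[01001] = record
  { width = 5
  ; before = false ∷ true ∷ false ∷ false ∷ true ∷ []
  ; spot = suc (suc zero)
  ; table = table[01001]
  ; spot-ascent = refl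
  ; checked = refl
  }



-- u 3 is the candidate position; each window is shifted so that its spot falls on it.
goodᵇ : (ℕ → Cell) → Bool
goodᵇ u = fitsᵇ (LocalMove.before move[0]) (shift 2 u)
       ∨ fitsᵇ (LocalMove.before move[100]) (shift 1 u)
       ∨ fitsᵇ (LocalMove.before move[01001]) u

good⇒insertion : ∀ {r} (S : Subset r) d → T (goodᵇ (shift (toℕ d) (padded S))) → DominatingInsertion S d
good⇒insertion S d t = [ by[0] , [ by[100] , by[01001] ]′ ∘ Equivalence.to T-∨ ]′ (Equivalence.to T-∨ t)
  where
  u = shift (toℕ d) (padded S)
  reshift : ∀ {k} (bs : Vec Bool k) o → T (fitsᵇ bs (shift o u)) →
            T (fitsᵇ bs (shift (toℕ d + o) (padded S)))
  reshift bs o = subst T (fitsᵇ-cong bs λ i → cong (padded S) (sym (+-assoc (toℕ d) o i)))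
  by[0] : T (fitsᵇ (LocalMove.before move[0]) (shift 2 u)) → DominatingInsertion S d
  by[0] t₀ =
    fits⇒insertion move[0] S (toℕ d + 2) (reshift (LocalMove.before move[0]) 2 t₀) d (sym (+-identityʳ _))
  by[100] : T (fitsᵇ (LocalMove.before move[100]) (shift 1 u)) → DominatingInsertion S d
  by[100] t₁ = fits⇒insertion move[100] S (toℕ d + 1) (reshift (LocalMove.before move[100]) 1 t₁) d
                               (sym (+-assoc (toℕ d) 1 1))
  by[01001] : T (fitsᵇ (LocalMove.before move[01001]) u) → DominatingInsertion S d
  by[01001] t₂ = fits⇒insertion move[01001] S (toℕ d) t₂ d refl

goodᵇ-cong : ∀ {u u′} → (∀ i → u i ≡ u′ i) → goodᵇ u ≡ goodᵇ u′
goodᵇ-cong eq = cong₂ _∨_ (fitsᵇ-cong (LocalMove.before move[0]) (eq ∘ (2 +_)))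
  (cong₂ _∨_ (fitsᵇ-cong (LocalMove.before move[100]) (eq ∘ (1 +_)))
             (fitsᵇ-cong (LocalMove.before move[01001]) eq))

-- Counting good positions

goodPositions : Cell → Cell → Cell → Subset n → List (Fin n)
goodPositions a b c [] = []
goodPositions a b c (x ∷ S) =
  consIf (goodᵇ (framed a b c (x ∷ S))) zero (map suc (goodPositions b c (cell x) S))

length-goodPositions : ∀ a b c x (S : Subset n) →
  length (goodPositions a b c (x ∷ S)) ≡
  indicator (goodᵇ (framed a b c (x ∷ S))) + length (goodPositions b c (cell x) S)
length-goodPositions a b c x S =
  trans (length-consIf (goodᵇ (framed a b c (x ∷ S))) zero (map suc tail))
        (cong (indicator (goodᵇ (framed a b c (x ∷ S))) +_) (length-map suc tail))
  where tail = goodPositions b c (cell x) S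

goodPositions-good : ∀ a b c (S : Subset n) →
  All (λ d → T (goodᵇ (shift (toℕ d) (framed a b c S)))) (goodPositions a b c S)
goodPositions-good a b c [] = []
goodPositions-good a b c (x ∷ S) = All-consIf {P = Good} (goodᵇ (framed a b c (x ∷ S))) id
  (Allₚ.map⁺ (All.map (λ {d} → subst T (goodᵇ-cong λ i → sym (framed-step a b c x S (toℕ d + i))))
                      (goodPositions-good b c (cell x) S)))
  where
  Good : Fin _ → Set
  Good d = T (goodᵇ (shift (toℕ d) (framed a b c (x ∷ S))))

goodPositions-unique : ∀ a b c (S : Subset n) → Unique (goodPositions a b c S)
goodPositions-unique a b c [] = []
goodPositions-unique a b c (x ∷ S) = Unique-consIf (goodᵇ (framed a b c (x ∷ S)))
  (Allₚ.map⁺ (All.universal (λ _ ()) _)) (Uniqueₚ.map⁺ Finₚ.suc-injective (goodPositions-unique b c (cell x) S))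

-- Found by a longest-path computation on windows; only potential-step, potential-end and
-- potential-start are used.
psi : Cell → Cell → Cell → Cell → Cell → Cell → ℕ
psi _ des des asc asc asc = 9
psi _ _ des asc asc asc = 7
psi des _ des asc asc des = 9
psi _ asc des asc asc des = 7
psi _ _ des asc asc des = 9
psi _ des des asc asc _ = 8
psi _ _ des asc asc _ = 6
psi _ _ _ asc asc out = 6
psi _ _ _ asc asc _ = 7
psi _ _ des asc des asc = 8
psi _ _ _ asc des asc = 7
psi _ _ _ asc des _ = 5
psi _ _ des asc _ out = 8
psi _ _ des asc _ _ = 2
psi _ _ _ asc _ out = 6
psi _ des _ des asc asc = 6
psi _ _ asc des asc asc = 4
psi _ _ _ des asc asc = 6
psi _ _ _ des asc _ = 5
psi _ _ _ des des asc = 3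
psi _ _ _ des des _ = 0
psi _ _ _ des _ out = 3
psi _ _ _ _ out out = 6
psi _ _ _ _ _ _ = 0

potential : (ℕ → Cell) → ℕ
potential u = psi (u 0) (u 1) (u 2) (u 3) (u 4) (u 5)

isOut : Cell → Bool
isOut out = true
isOut _ = false

fromCells : ∀ {k} → Vec Cell k → ℕ → Cell
fromCells [] _ = out
fromCells (c ∷ cs) zero = c
fromCells (c ∷ cs) (suc i) = fromCells cs i

∀ᶜ : (Cell → Bool) → Bool
∀ᶜ f = f out ∧ f asc ∧ f des

∀ᶜ-sound : ∀ f → T (∀ᶜ f) → ∀ c → T (f c)
∀ᶜ-sound f t out = proj₁ (Equivalence.to (T-∧ {f out}) t)
∀ᶜ-sound f t asc = proj₁ (Equivalence.to (T-∧ {f asc}) (proj₂ (Equivalence.to (T-∧ {f out}) t)))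
∀ᶜ-sound f t des = proj₂ (Equivalence.to (T-∧ {f asc}) (proj₂ (Equivalence.to (T-∧ {f out}) t)))

open Exhaustive ∀ᶜ ∀ᶜ-sound

by-exhaustion : ∀ k (P : (ℕ → Cell) → Bool) → ∀ᵛ k (P ∘ fromCells) ≡ true → ∀ v → T (P (fromCells v))
by-exhaustion k P holds = ∀ᵛ-sound k (P ∘ fromCells) (subst T (sym holds) tt)

descent-weight : Cell → ℕ
descent-weight c = indicator (not (free c))

stepᵇ : (ℕ → Cell) → Bool
stepᵇ u =
  isOut (u 3) ∨ (potential (u ∘ suc) + 2 ≤ᵇ 2 * indicator (goodᵇ u) + 5 * descent-weight (u 3) + potential u)

potential-step : ∀ u → u 3 ≢ out →
  potential (u ∘ suc) + 2 ≤ 2 * indicator (goodᵇ u) + 5 * descent-weight (u 3) + potential u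
potential-step u inside =
  ≤ᵇ⇒≤ _ _ (drop-out (u 3) inside (by-exhaustion 7 stepᵇ refl (u 0 ∷ u 1 ∷ u 2 ∷ u 3 ∷ u 4 ∷ u 5 ∷ u 6 ∷ [])))
  where
  drop-out : ∀ c {b} → c ≢ out → T (isOut c ∨ b) → T b
  drop-out out ne _ = ⊥-elim (ne refl)
  drop-out asc ne t = t
  drop-out des ne t = t

potential-end : ∀ a b c → 6 ≤ psi a b c out out out
potential-end a b c = ≤ᵇ⇒≤ _ _ (by-exhaustion 3 (λ u → 6 ≤ᵇ psi (u 0) (u 1) (u 2) out out out) refl (a ∷ b ∷ c ∷ []))

potential-start : ∀ a b c → psi out out out a b c ≤ 7
potential-start a b c = ≤ᵇ⇒≤ _ _ (by-exhaustion 3 (λ u → psi out out out (u 0) (u 1) (u 2) ≤ᵇ 7) refl (a ∷ b ∷ c ∷ []))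

descent-weight-cell : ∀ x → descent-weight (cell x) ≡ indicator x
descent-weight-cell false = refl
descent-weight-cell true = refl

accumulate : ∀ {n G B P g b Q} → 2 * n + 6 ≤ 2 * G + 5 * B + P → P + 2 ≤ 2 * g + 5 * b + Q →
             2 * suc n + 6 ≤ 2 * (g + G) + 5 * (b + B) + Q
accumulate {n} {G} {B} {P} {g} {b} {Q} before-step step = begin
  2 * suc n + 6                           ≡⟨ shift-two n ⟩
  (2 * n + 6) + 2                         ≤⟨ +-monoˡ-≤ 2 before-step ⟩
  (2 * G + 5 * B + P) + 2                 ≡⟨ +-assoc (2 * G + 5 * B) P 2 ⟩
  2 * G + 5 * B + (P + 2)                 ≤⟨ +-monoʳ-≤ (2 * G + 5 * B) step ⟩
  2 * G + 5 * B + (2 * g + 5 * b + Q)     ≡⟨ regroup G B g b Q ⟩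
  2 * (g + G) + 5 * (b + B) + Q           ∎
  where
  open ≤-Reasoning
  shift-two : ∀ n → 2 * suc n + 6 ≡ (2 * n + 6) + 2
  shift-two = solve-∀
  regroup : ∀ G B g b Q → 2 * G + 5 * B + (2 * g + 5 * b + Q) ≡ 2 * (g + G) + 5 * (b + B) + Q
  regroup = solve-∀

potential-invariant : ∀ a b c (S : Subset n) →
  2 * n + 6 ≤ 2 * length (goodPositions a b c S) + 5 * ∣ S ∣ + potential (framed a b c S)
potential-invariant a b c [] = potential-end a b c
potential-invariant {suc n} a b c (x ∷ S) =
  subst₂ (λ G B → 2 * suc n + 6 ≤ 2 * G + 5 * B + potential u)
         (sym (length-goodPositions a b c x S)) (sym (∣∷∣ x S))
         (accumulate {n} {length (goodPositions b c (cell x) S)} {∣ S ∣} {potential (u ∘ suc)}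
                     {indicator (goodᵇ u)} {indicator x} {potential u} (potential-invariant b c (cell x) S)
                     (subst (λ k → potential (u ∘ suc) + 2 ≤ 2 * indicator (goodᵇ u) + 5 * k + potential u)
                            (descent-weight-cell x) (potential-step u (cell≢out x))))
  where u = framed a b c (x ∷ S)

goodPositions-count : ∀ (S : Subset n) → 2 * n ≤ 2 * length (goodPositions out out out S) + 5 * ∣ S ∣ + 1
goodPositions-count S = +-cancelʳ-≤ 6 _ _ (≤-trans (potential-invariant out out out S)
  (≤-trans (+-monoʳ-≤ _ (potential-start (at S 0) (at S 1) (at S 2))) (≤-reflexive (sym (+-assoc _ 1 6)))))

half-bound : ∀ r i G → 2 * r ≤ 2 * G + 5 * i + 1 → (2 * r ∸ 5 * i) / 2 ≤ G
half-bound r i G h = ≤-pred (m<n*o⇒m/o<n (subst (2 * r ∸ 5 * i <_) (e₂ G)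
  (s≤s (m≤n+o⇒m∸n≤o (2 * r) (5 * i) (subst (2 * r ≤_) (e₁ G i) h)))))
  where
  e₁ : ∀ G i → 2 * G + 5 * i + 1 ≡ 5 * i + (2 * G + 1)
  e₁ = solve-∀
  e₂ : ∀ G → suc (2 * G + 1) ≡ suc G * 2
  e₂ = solve-∀

lemma6p1 : (r i : ℕ) (T : Subset r) → ∣ T ∣ ≡ i →
    ∃[ Ss ] (Unique Ss × ((2 * r ∸ 5 * i) / 2 ≤ length Ss)
    × All (λ S → T ⊆ S × ∣ S ∣ ≡ suc i × Dominates S T) Ss)
lemma6p1 r i T ∣T∣≡i =
  map insert ds ,
  Unique-map-on insert (λ d∉ _ → insert-injective T d∉) (All.map proj₁ insertions)
                (goodPositions-unique out out out T) ,
  subst ((2 * r ∸ 5 * i) / 2 ≤_) (sym (length-map insert ds))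
    (half-bound r i (length ds)
      (subst (λ k → 2 * r ≤ 2 * length ds + 5 * k + 1) ∣T∣≡i (goodPositions-count T))) ,
  Allₚ.map⁺ (All.map extension insertions)
  where
  ds = goodPositions out out out T
  insert : Fin r → Subset r
  insert d = T [ d ]≔ true
  insertions : All (DominatingInsertion T) ds
  insertions = All.map (good⇒insertion T _) (goodPositions-good out out out T)
  extension : ∀ {d} → DominatingInsertion T d → T ⊆ insert d × ∣ insert d ∣ ≡ suc i × Dominates (insert d) T
  extension {d} (d∉ , dominates) = ⊆-insert T d , trans (∣insert∣ T d d∉) (cong suc ∣T∣≡i) , dominates
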